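{- Let $L$ be a regular language of strings over a finite alphabet $\Lambda$, given by a deterministic finite automaton (more generally, let $L$ range over an explicitly regular family), and order strings by $a\preceq b$ iff $a$ is a (not necessarily contiguous) subsequence of $b$. Then the language $B_L'=\{x\mathbin{\#}y : (x,y)\text{ is an }L\text{ -semibad pair}\}$ over $\Lambda\sqcup\{\#\}$ is explicitly regular, i.e. a finite automaton recognizing it can be computed from an automaton recognizing $L$.
   Context: $\#$ is a symbol not in $\Lambda$ and $x\mathbin{\#}y$ denotes concatenation of $x$, $\#$, $y$. For strings $x,y$ over $\Lambda$, $(x,y)$ is an $L$-semibad pair if there is no $z\in L$ with $x\preceq z$ and $y\preceq z$. A family of languages is explicitly regular if there is an algorithm which, given a description of a member, constructs a finite automaton recognizing it. -}

module Defs where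

open import Data.Nat using (ℕ)
open import Data.Fin using (Fin)
open import Data.Bool using (Bool; true)
open import Data.List using (List; []; _∷_; _++_; map; foldl)
open import Data.Sum using (_⊎_; inj₁; inj₂)
open import Data.Unit using (⊤; tt)
open import Data.Product using (Σ; ∃; _×_; _,_)
open import Relation.Nullary using (¬_)
open import Relation.Binary.PropositionalEquality using (_≡_)
import Data.List.Relation.Binary.Sublist.Propositional as Sub

record DFA (A : Set) : Set where
  field
    states : ℕ
    start  : Fin states
    δ      : Fin states → A → Fin states
    final  : Fin states → Bool


Accepts : ∀ {A} → DFA A → List A → Set
Accepts M w = DFA.final M (foldl (DFA.δ M) (DFA.start M) w) ≡ true

_⪯_ : ∀ {A : Set} → List A → List A → Set
_⪯_ {A} = Sub._⊆_ {A = A}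

SemiBad : ∀ {A} → (List A → Set) → List A → List A → Set
SemiBad L x y = ¬ (∃ λ z → L z × x ⪯ z × y ⪯ z)

-- The separator symbol # (named hash) (the extended alphabet is Λ ⊔ {#} = Λ ⊎ ⊤).
hash : ∀ {Λ : Set} → Λ ⊎ ⊤
hash = inj₂ tt

infixr 5 _#_
_#_ : ∀ {Λ : Set} → List Λ → List Λ → List (Λ ⊎ ⊤)
x # y = map inj₁ x ++ (hash ∷ map inj₁ y)

B′ : ∀ {Λ : Set} → (List Λ → Set) → List (Λ ⊎ ⊤) → Set
B′ L w = ∃ λ x → ∃ λ y → (w ≡ x # y) × SemiBad L x y

module Submission where

-- Cutting the
-- run on z at the last visit of its first state, then at the last visit of the next state,
-- and so on, exhibits z inside a language G₁* b₁ G₂* b₂ ⋯ Gₘ* bₘ (a skeleton) with m ≤ n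
-- distinct pivots, where Gᵢ is the set of letters lying on a cycle through the i-th pivot
-- and bᵢ an optional letter. Conversely two words embedding into the language of a
-- skeleton that some accepting run can follow embed into a common accepted word: each
-- letter of Gᵢ is produced by going once around a cycle through the i-th pivot. Whether a
-- word embeds into a skeleton language is decided greedily, by an automaton whose states
-- are the suffixes of the skeleton; running one such automaton per skeleton of length n
-- (shorter ones are padded) on x, restarting the survivors at #, and running them on y
-- decides whether x # y lies in B′.

open import Defs
open import Data.Bool using (Bool; true; false; _∧_)
import Data.Bool as Bool
open import Data.Empty using (⊥-elim)
open import Data.Fin using (Fin; zero; suc; toℕ; fromℕ<)
open import Data.Fin.Properties using (_≟_; any?; all?; injective⇒≤; toℕ-fromℕ<; +↔⊎; *↔×; 1↔⊤)
open import Data.List using (List; []; _∷_; _++_; map; foldl; length; drop; take; replicate; fromMaybe)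
import Data.List as List
open import Data.List.Membership.Propositional using (_∉_)
open import Data.List.Membership.Propositional.Properties using (∈-lookup)
open import Data.List.Properties using (foldl-++; length-++; ++-assoc; ++-identityʳ; take++drop≡id)
open import Data.List.Relation.Binary.Sublist.Heterogeneous using ([]; _∷_; _∷ʳ_)
open import Data.List.Relation.Binary.Sublist.Propositional.Properties using ([]⊆-universal; ++⁺ˡ)
open import Data.List.Relation.Unary.All using (All; []; _∷_)
import Data.List.Relation.Unary.All as All
open import Data.List.Relation.Unary.All.Properties using (¬Any⇒All¬)
open import Data.List.Relation.Unary.Any using (here; there)
open import Data.List.Relation.Unary.Unique.Propositional using (Unique; []; _∷_)
open import Data.Maybe using (Maybe; just; nothing; is-just)
open import Data.Maybe.Properties using (just-injective)
import Data.Maybe.Properties as Maybe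
open import Data.Nat using (ℕ; _+_; _*_; _^_; _∸_; _≤_; _<_; s≤s; z≤n)
import Data.Nat as ℕ
open import Data.Nat.Properties
  using (≤-refl; ≤-reflexive; ≤-trans; <⇒≤; m∸n≤m; m+n∸n≡m; m≤n+m; +-suc; +-identityʳ)
open import Data.Product using (Σ; ∃; _×_; _,_; proj₁; proj₂)
open import Data.Product.Function.NonDependent.Propositional using (_×-↔_)
open import Data.Sum using (_⊎_; inj₁; inj₂)
open import Data.Sum.Function.Propositional using (_⊎-↔_)
open import Data.Unit using (⊤; tt)
open import Data.Vec using (Vec; []; _∷_; tabulate; lookup; toList)
import Data.Vec as Vec
open import Data.Vec.Properties using (lookup∘tabulate; lookup-map; lookup-replicate; length-toList)
open import Data.Vec.Recursive using (lift↔; Fin[m^n]↔Fin[m]^n)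
open import Data.Vec.Recursive.Properties using (↔Vec)
open import Function.Base using (id; _∘_)
open import Function.Bundles using (_↔_; mk↔ₛ′; Inverse; _⇔_; mk⇔; Equivalence)
import Function.Properties.Equivalence as ⇔
open import Function.Properties.Inverse using (↔-refl; ↔-trans)
open import Relation.Binary.PropositionalEquality
  using (_≡_; _≢_; refl; sym; trans; cong; subst; module ≡-Reasoning)
open import Relation.Nullary using (Dec; yes; no; ¬_; does)
open import Relation.Nullary.Decidable using (map′; _×-dec_; ¬?)

drop-suffix : ∀ {X : Set} (ρ τ : List X) → drop (length (ρ ++ τ) ∸ length τ) (ρ ++ τ) ≡ τ
drop-suffix ρ τ rewrite length-++ ρ {τ} | m+n∸n≡m (length ρ) (length τ) = drop-length-++ ρ
  where
    drop-length-++ : ∀ ρ → drop (length ρ) (ρ ++ τ) ≡ τ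
    drop-length-++ []      = refl
    drop-length-++ (_ ∷ ρ) = drop-length-++ ρ

padTo : ∀ {X : Set} m (e : X) (xs : List X) → length xs ≤ m →
        Σ (Vec X m) λ v → ∃ λ r → toList v ≡ xs ++ replicate r e
padTo ℕ.zero    e []       _         = [] , 0 , refl
padTo (ℕ.suc m) e []       _         with padTo m e [] z≤n
... | v , r , eq = e ∷ v , ℕ.suc r , cong (e ∷_) eq
padTo (ℕ.suc m) e (x ∷ xs) (s≤s xs≤m) with padTo m e xs xs≤m
... | v , r , eq = x ∷ v , r , cong (x ∷_) eq

unique⇒length≤ : ∀ {n} {xs : List (Fin n)} → Unique xs → length xs ≤ n
unique⇒length≤ u = injective⇒≤ (lookup-injective u)
  where
    lookup-injective : ∀ {A : Set} {xs : List A} → Unique xs → ∀ {i j} → List.lookup xs i ≡ List.lookup xs j → i ≡ j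
    lookup-injective {xs = _ ∷ _} _        {zero}  {zero}  _ = refl
    lookup-injective {xs = _ ∷ _} (x∉ ∷ _) {zero}  {suc j} e = ⊥-elim (All.lookup x∉ (∈-lookup j) e)
    lookup-injective {xs = _ ∷ _} (x∉ ∷ _) {suc i} {zero}  e = ⊥-elim (All.lookup x∉ (∈-lookup i) (sym e))
    lookup-injective {xs = _ ∷ _} (_ ∷ u)  {suc i} {suc j} e = cong suc (lookup-injective u e)

∧≡true : ∀ {a b} → a ∧ b ≡ true ⇔ (a ≡ true × b ≡ true)
∧≡true {true}  = mk⇔ (refl ,_) proj₂
∧≡true {false} = mk⇔ (λ ()) proj₁

does⇔ : ∀ {P : Set} (p? : Dec P) → does p? ≡ true ⇔ P
does⇔ (yes p) = mk⇔ (λ _ → p) (λ _ → refl)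
does⇔ (no ¬p) = mk⇔ (λ ()) (λ p → ⊥-elim (¬p p))

Maybe-↔ : ∀ {N} {A : Set} → Fin N ↔ A → Fin (ℕ.suc N) ↔ Maybe A
Maybe-↔ {A = A} e = mk↔ₛ′ to from to∘from from∘to
  where
    open Inverse e renaming (to to toA; from to fromA)
    to : Fin _ → Maybe A
    to zero    = nothing
    to (suc i) = just (toA i)
    from : Maybe A → Fin _
    from nothing  = zero
    from (just a) = suc (fromA a)
    to∘from : ∀ m → to (from m) ≡ m
    to∘from nothing  = refl
    to∘from (just a) = cong just (strictlyInverseˡ a)
    from∘to : ∀ i → from (to i) ≡ i
    from∘to zero    = refl
    from∘to (suc i) = cong suc (strictlyInverseʳ i)

Vec-↔ : ∀ {N} {A : Set} m → Fin N ↔ A → Fin (N ^ m) ↔ Vec A m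
Vec-↔ {N} m e = ↔-trans (Fin[m^n]↔Fin[m]^n N m) (↔-trans (lift↔ m e) (↔Vec m))

record Machine (A S : Set) : Set where
  field
    start  : S
    step   : S → A → S
    accept : S → Bool

  run : S → List A → S
  run = foldl step

  Accepted : List A → Set
  Accepted w = accept (run start w) ≡ true

module _ {A S : Set} {N : ℕ} (enum : Fin N ↔ S) (m : Machine A S) where
  open Inverse enum
  open Machine m

  toDFA : DFA A
  toDFA = record
    { states = N
    ; start  = from start
    ; δ      = λ i a → from (step (to i) a)
    ; final  = λ i → accept (to i) }

  toDFA-run : ∀ s w → to (foldl (DFA.δ toDFA) (from s) w) ≡ run s w
  toDFA-run s []      = strictlyInverseˡ s
  toDFA-run s (a ∷ w) rewrite strictlyInverseˡ s = toDFA-run (step s a) w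

  toDFA-accepts : ∀ w → Accepts toDFA w ⇔ Accepted w
  toDFA-accepts w = mk⇔ (subst (λ s → accept s ≡ true) (toDFA-run start w))
                        (subst (λ s → accept s ≡ true) (sym (toDFA-run start w)))

data Phase (S : Set) : Set where
  before# : S → Phase S
  after#  : S → Phase S
  dead    : Phase S

Phase-↔ : ∀ {N} {S : Set} → Fin N ↔ S → Fin (N + (N + 1)) ↔ Phase S
Phase-↔ e = ↔-trans +↔⊎ (↔-trans (e ⊎-↔ ↔-trans +↔⊎ (e ⊎-↔ 1↔⊤)) sum↔phase)
  where
    sum↔phase : _ ↔ Phase _
    sum↔phase = mk↔ₛ′
      (λ { (inj₁ s) → before# s ; (inj₂ (inj₁ s)) → after# s ; (inj₂ (inj₂ tt)) → dead })
      (λ { (before# s) → inj₁ s ; (after# s) → inj₂ (inj₁ s) ; dead → inj₂ (inj₂ tt) })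
      (λ { (before# s) → refl ; (after# s) → refl ; dead → refl })
      (λ { (inj₁ s) → refl ; (inj₂ (inj₁ s)) → refl ; (inj₂ (inj₂ tt)) → refl })

data HashSplit {A : Set} : List (A ⊎ ⊤) → Set where
  letters : ∀ x → HashSplit (map inj₁ x)
  at-hash : ∀ x w → HashSplit (map inj₁ x ++ hash ∷ w)

hashSplit : ∀ {A : Set} (w : List (A ⊎ ⊤)) → HashSplit w
hashSplit []            = letters []
hashSplit (inj₂ tt ∷ w) = at-hash [] w
hashSplit (inj₁ a ∷ w)  with hashSplit w
... | letters x   = letters (a ∷ x)
... | at-hash x v = at-hash (a ∷ x) v

module _ {A S : Set} (m : Machine A S) (reset : S → S) where
  open Machine m

  separated : Machine (A ⊎ ⊤) (Phase S)
  separated = record { start = before# start ; step = step′ ; accept = accept′ }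
    where
      step′ : Phase S → A ⊎ ⊤ → Phase S
      step′ (before# s) (inj₁ a) = before# (step s a)
      step′ (before# s) (inj₂ _) = after# (reset s)
      step′ (after# s)  (inj₁ a) = after# (step s a)
      step′ (after# s)  (inj₂ _) = dead
      step′ dead        _        = dead
      accept′ : Phase S → Bool
      accept′ (after# s) = accept s
      accept′ _          = false

  private
    module ⁺ = Machine separated

  run-before# : ∀ s x → ⁺.run (before# s) (map inj₁ x) ≡ before# (run s x)
  run-before# s []      = refl
  run-before# s (a ∷ x) = run-before# (step s a) x

  run-after# : ∀ s x → ⁺.run (after# s) (map inj₁ x) ≡ after# (run s x)
  run-after# s []      = refl
  run-after# s (a ∷ x) = run-after# (step s a) x

  run-dead : ∀ w → ⁺.run dead w ≡ dead
  run-dead []      = refl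
  run-dead (_ ∷ w) = run-dead w

  run-first# : ∀ s x w → ⁺.run (before# s) (map inj₁ x ++ hash ∷ w) ≡ ⁺.run (after# (reset (run s x))) w
  run-first# s x w = trans (foldl-++ ⁺.step (before# s) (map inj₁ x) (hash ∷ w))
                           (cong (λ p → ⁺.run p (hash ∷ w)) (run-before# s x))

  run-second# : ∀ s y w → ⁺.run (after# s) (map inj₁ y ++ hash ∷ w) ≡ dead
  run-second# s y w = trans (foldl-++ ⁺.step (after# s) (map inj₁ y) (hash ∷ w))
                            (trans (cong (λ p → ⁺.run p (hash ∷ w)) (run-after# s y)) (run-dead w))

  run-# : ∀ x y → ⁺.run ⁺.start (x # y) ≡ after# (run (reset (run start x)) y)
  run-# x y = trans (run-first# start x (map inj₁ y)) (run-after# _ y)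

  separated-accepts : {R : List A → List A → Set} →
    (∀ x y → accept (run (reset (run start x)) y) ≡ true ⇔ R x y) →
    ∀ w → ⁺.Accepted w ⇔ ∃ λ x → ∃ λ y → w ≡ x # y × R x y
  separated-accepts {R} R⇔ w = mk⇔ (to (hashSplit w)) from
    where
      accepted : ∀ {p q} → p ≡ q → ⁺.accept p ≡ true → ⁺.accept q ≡ true
      accepted e = subst (λ p → ⁺.accept p ≡ true) e
      to : ∀ {w} → HashSplit w → ⁺.Accepted w → ∃ λ x → ∃ λ y → w ≡ x # y × R x y
      to (letters x) acc with accepted (run-before# start x) acc
      ... | ()
      to (at-hash x u) acc with hashSplit u
      ... | letters y = x , y , refl , Equivalence.to (R⇔ x y) (accepted (run-# x y) acc)
      ... | at-hash y v with accepted (trans (run-first# start x _) (run-second# _ y v)) acc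
      ...   | ()
      from : (∃ λ x → ∃ λ y → w ≡ x # y × R x y) → ⁺.Accepted w
      from (x , y , refl , r) = accepted (sym (run-# x y)) (Equivalence.from (R⇔ x y) r)

module _ {A S : Set} {K : ℕ} (step : Fin K → S → A → S) where

  stepAll : Vec S K → A → Vec S K
  stepAll v a = tabulate λ i → step i (lookup v i) a

  lookup-runAll : ∀ v x i → lookup (foldl stepAll v x) i ≡ foldl (step i) (lookup v i) x
  lookup-runAll v []      i = refl
  lookup-runAll v (a ∷ x) i = trans (lookup-runAll (stepAll v a) x i)
                                    (cong (λ s → foldl (step i) s x) (lookup∘tabulate _ i))

module PartialRun {T A : Set} (step : T → A → Maybe T) where

  survives : Maybe T → List A → Bool
  survives nothing  _       = false
  survives (just t) []      = true
  survives (just t) (a ∷ x) = survives (step t a) x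

Position : ℕ → Set
Position m = Maybe (Fin (ℕ.suc m))

restart : ∀ {m} → Position m → Position m
restart nothing  = nothing
restart (just _) = just zero

-- A partial machine whose steps only ever shorten the state to a suffix can be run on
-- the suffixes of one list σ, which are finitely many: the suffix dropping i elements is
-- recorded as just i, and nothing records a failed run.
module SuffixPositions {X A : Set} (step : List X → A → Maybe (List X))
    (step-suffix : ∀ σ a τ → step σ a ≡ just τ → ∃ λ ρ → σ ≡ ρ ++ τ)
    (m : ℕ) (σ : List X) (σ≤m : length σ ≤ m) where
  open PartialRun step

  suffixAt : Position m → Maybe (List X)
  suffixAt nothing  = nothing
  suffixAt (just i) = just (drop (toℕ i) σ)

  positionOf : Maybe (List X) → Position m
  positionOf nothing  = nothing
  positionOf (just τ) = just (fromℕ< (s≤s (≤-trans (m∸n≤m (length σ) (length τ)) σ≤m)))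

  suffixAt-positionOf : ∀ τ → (∃ λ ρ → σ ≡ ρ ++ τ) → suffixAt (positionOf (just τ)) ≡ just τ
  suffixAt-positionOf τ (ρ , refl) = cong just (trans (cong (λ j → drop j σ) (toℕ-fromℕ< {m = length σ ∸ length τ} _)) (drop-suffix ρ τ))

  stepPosition : Position m → A → Position m
  stepPosition nothing  a = nothing
  stepPosition (just i) a = positionOf (step (drop (toℕ i) σ) a)

  suffixAt-stepPosition : ∀ i a → suffixAt (stepPosition (just i) a) ≡ step (drop (toℕ i) σ) a
  suffixAt-stepPosition i a with step (drop (toℕ i) σ) a in eq
  ... | nothing = refl
  ... | just τ with step-suffix (drop (toℕ i) σ) a τ eq
  ...   | ρ , e = suffixAt-positionOf τ (take (toℕ i) σ ++ ρ , (begin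
          σ                                ≡⟨ take++drop≡id (toℕ i) σ ⟨
          take (toℕ i) σ ++ drop (toℕ i) σ ≡⟨ cong (take (toℕ i) σ ++_) e ⟩
          take (toℕ i) σ ++ ρ ++ τ         ≡⟨ ++-assoc (take (toℕ i) σ) ρ τ ⟨
          (take (toℕ i) σ ++ ρ) ++ τ       ∎))
    where open ≡-Reasoning

  is-just-run : ∀ p x → is-just (foldl stepPosition p x) ≡ survives (suffixAt p) x
  is-just-run nothing  []      = refl
  is-just-run (just i) []      = refl
  is-just-run nothing  (a ∷ x) = is-just-run nothing x
  is-just-run (just i) (a ∷ x) = trans (is-just-run (stepPosition (just i) a) x)
                                       (cong (λ t → survives t x) (suffixAt-stepPosition i a))

  is-just-restart : ∀ x y →
    is-just (foldl stepPosition (restart (foldl stepPosition (just zero) x)) y)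
      ≡ survives (just σ) x ∧ survives (just σ) y
  is-just-restart x y with foldl stepPosition (just zero) x | is-just-run (just zero) x
  ... | nothing | e = trans (is-just-run nothing y) (cong (_∧ survives (just σ) y) e)
  ... | just _  | e = trans (is-just-run (just zero) y) (cong (_∧ survives (just σ) y) e)

module Runs {A : Set} (M : DFA A) where
  open DFA M renaming (states to n)

  Q : Set
  Q = Fin n

  run : Q → List A → Q
  run = foldl δ

  run-++ : ∀ p u v → run p (u ++ v) ≡ run (run p u) v
  run-++ = foldl-++ δ

  Reach : Q → Q → Set
  Reach p q = ∃ λ u → run p u ≡ q

  reach-refl : ∀ {p} → Reach p p
  reach-refl = [] , refl

  reach-trans : ∀ {p q r} → Reach p q → Reach q r → Reach p r
  reach-trans {p} (u , refl) (v , refl) = u ++ v , run-++ p u v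

  reach-step : ∀ {p q} a → Reach p q → Reach p (δ q a)
  reach-step a pq = reach-trans pq (a ∷ [] , refl)

  visits : Q → List A → List Q
  visits s []      = s ∷ []
  visits s (a ∷ z) = s ∷ visits (δ s a) z

  first-visit : ∀ {P : Q → Set} s z → All P (visits s z) → P s
  first-visit s []      (ps ∷ _) = ps
  first-visit s (_ ∷ _) (ps ∷ _) = ps

  visits-++ : ∀ {P : Q → Set} s u v → All P (visits s (u ++ v)) → All P (visits (run s u) v)
  visits-++ s []      v ps       = ps
  visits-++ s (a ∷ u) v (_ ∷ ps) = visits-++ (δ s a) u v ps

  data LastVisit (p s : Q) : List A → Set where
    never  : ∀ {z} → All (_≢ p) (visits s z) → LastVisit p s z
    at-end : ∀ {z} → run s z ≡ p → LastVisit p s z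
    before : ∀ {u a v} → run s u ≡ p → All (_≢ p) (visits (δ p a) v) → LastVisit p s (u ++ a ∷ v)

  lastVisit : ∀ p s z → LastVisit p s z
  lastVisit p s [] with s ≟ p
  ... | yes s≡p = at-end s≡p
  ... | no  s≢p = never (s≢p ∷ [])
  lastVisit p s (a ∷ z) with lastVisit p (δ s a) z
  ... | at-end r            = at-end r
  ... | before {u} r later = before {u = a ∷ u} r later
  ... | never later with s ≟ p
  ...   | yes refl = before {u = []} refl later
  ...   | no  s≢p  = never (s≢p ∷ later)

  -- A run from s on z, cut at the last visit of s, then at the last visit of the next
  -- state, and so on: each piece is a loop at its pivot, followed by one letter.
  data Loops (s : Q) : List A → Set where
    last : ∀ {z} → run s z ≡ s → Loops s z
    step : ∀ {u a v} → run s u ≡ s → Loops (δ s a) v → Loops s (u ++ a ∷ v)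

  size : ∀ {s z} → Loops s z → ℕ
  size (last _)   = 1
  size (step _ d) = ℕ.suc (size d)

  private
    length-tail< : ∀ (u : List A) a v → length v < length (u ++ a ∷ v)
    length-tail< u a v = subst (length v <_) (sym (length-++ u)) (m≤n+m (ℕ.suc (length v)) (length u))

    -- av holds the earlier pivots, which the rest of the run avoids; as all pivots are
    -- distinct there are at most n pieces.
    loopsAvoiding : ∀ t s z (av : List Q) → length z < t → Unique av → All (_∉ av) (visits s z) →
                    Σ (Loops s z) λ d → size d + length av ≤ n
    loopsAvoiding (ℕ.suc t) s z av (s≤s z≤t) uav avoid with first-visit s z avoid | lastVisit s s z
    ... | s∉av | never later = ⊥-elim (first-visit s z later refl)
    ... | s∉av | at-end r    = last r , unique⇒length≤ (¬Any⇒All¬ av s∉av ∷ uav)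
    ... | s∉av | before {u} {a} {v} r later
      with loopsAvoiding t (δ s a) v (s ∷ av) (≤-trans (length-tail< u a v) z≤t)
                         (¬Any⇒All¬ av s∉av ∷ uav) (All.zipWith avoidBoth (later , avoid′))
      where
        avoid′ : All (_∉ av) (visits (δ s a) v)
        avoid′ = subst (λ p → All (_∉ av) (visits (δ p a) v)) r (All.tail (visits-++ s u (a ∷ v) avoid))
        avoidBoth : ∀ {q} → q ≢ s × q ∉ av → q ∉ s ∷ av
        avoidBoth (q≢s , _)   (here q≡s) = q≢s q≡s
        avoidBoth (_ , q∉av) (there q∈) = q∉av q∈
    ...   | d , bound = step r d , subst (_≤ n) (+-suc (size d) (length av)) bound

  loops : ∀ s z → Σ (Loops s z) λ d → size d ≤ n
  loops s z with loopsAvoiding (ℕ.suc (length z)) s z [] ≤-refl [] (All.universal (λ _ ()) (visits s z))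
  ... | d , bound = d , subst (_≤ n) (+-identityʳ (size d)) bound

  shortcut : ∀ {s z} (d : Loops s z) → ∃ λ u → run s u ≡ run s z × length u < size d
  shortcut (last r) = [] , sym r , s≤s z≤n
  shortcut {s} (step {u} {a} {v} r d) with shortcut d
  ... | w , e , bound = a ∷ w , trans e (sym (trans (run-++ s u (a ∷ v)) (cong (λ p → run p (a ∷ v)) r))) , s≤s bound

  reach-short : ∀ {p q} → Reach p q → ∃ λ u → length u ≤ n × run p u ≡ q
  reach-short {p} (z , refl) with loops p z
  ... | d , d≤n with shortcut d
  ...   | u , e , u<d = u , ≤-trans (<⇒≤ u<d) d≤n , e

module Skeletons {k : ℕ} (M : DFA (Fin k)) where
  open DFA M renaming (states to n)
  open Runs M public

  Λ : Set
  Λ = Fin k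

  reachWithin? : ∀ t p q → Dec (∃ λ u → length u ≤ t × run p u ≡ q)
  reachWithin? ℕ.zero p q with p ≟ q
  ... | yes p≡q = yes ([] , z≤n , p≡q)
  ... | no  p≢q = no λ { ([] , _ , p≡q) → p≢q p≡q ; (_ ∷ _ , () , _) }
  reachWithin? (ℕ.suc t) p q with p ≟ q | any? (λ a → reachWithin? t (δ p a) q)
  ... | yes p≡q | _                     = yes ([] , z≤n , p≡q)
  ... | no  _   | yes (a , u , u≤t , e) = yes (a ∷ u , s≤s u≤t , e)
  ... | no  p≢q | no  none              =
    no λ { ([] , _ , p≡q) → p≢q p≡q ; (a ∷ u , s≤s u≤t , e) → none (a , u , u≤t , e) }

  reach? : ∀ p q → Dec (Reach p q)
  reach? p q = map′ (λ (u , _ , e) → u , e) reach-short (reachWithin? n p q)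

  LoopLetter : Q → Λ → Set
  LoopLetter p a = ∃ λ r → Reach p r × Reach (δ r a) p

  loopLetter? : ∀ p a → Dec (LoopLetter p a)
  loopLetter? p a = any? λ r → reach? p r ×-dec reach? (δ r a) p

  loopLetters : ∀ {p q} u → Reach p q → run q u ≡ p → All (LoopLetter p) u
  loopLetters         []      _  _ = []
  loopLetters {q = q} (a ∷ u) pq e = (q , pq , u , e) ∷ loopLetters u (reach-step a pq) e

  loopAround : ∀ {p a} → LoopLetter p a → ∃ λ w → run p w ≡ p × (∀ {x u} → x ⪯ u → (a ∷ x) ⪯ (w ++ u))
  loopAround {p} {a} (r , (u , pr) , (v , rp)) =
    u ++ a ∷ v ,
    trans (run-++ p u (a ∷ v)) (trans (cong (λ q → run (δ q a) v) pr) rp) ,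
    λ {_} {w} xw → subst ((_ ∷ _) ⪯_) (sym (++-assoc u (a ∷ v) w)) (++⁺ˡ u (refl ∷ ++⁺ˡ v xw))

  -- The segment (p , b) denotes the words G* b, where G is the set of loop letters at p
  -- and b an optional exit letter; a skeleton denotes the concatenation of its segments.
  Segment : Set
  Segment = Q × Maybe Λ

  Skeleton : Set
  Skeleton = List Segment

  exit? : ∀ (b : Maybe Λ) a → Dec (b ≡ just a)
  exit? b a = Maybe.≡-dec _≟_ b (just a)

  -- One letter of a greedy embedding into the words denoted by a skeleton: what is left
  -- of the skeleton, or nothing when the embedding fails.
  match : Skeleton → Λ → Maybe Skeleton
  match []            a = nothing
  match ((p , b) ∷ σ) a with loopLetter? p a | exit? b a
  ... | yes _ | _     = just ((p , b) ∷ σ)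
  ... | no  _ | yes _ = just σ
  ... | no  _ | no  _ = match σ a

  match-loop : ∀ {p a} b σ → LoopLetter p a → match ((p , b) ∷ σ) a ≡ just ((p , b) ∷ σ)
  match-loop {p} {a} b σ l with loopLetter? p a
  ... | yes _ = refl
  ... | no ¬l = ⊥-elim (¬l l)

  match-exit : ∀ {p a} σ → ¬ LoopLetter p a → match ((p , just a) ∷ σ) a ≡ just σ
  match-exit {p} {a} σ ¬l with loopLetter? p a | exit? (just a) a
  ... | yes l | _     = ⊥-elim (¬l l)
  ... | no  _ | yes _ = refl
  ... | no  _ | no ¬e = ⊥-elim (¬e refl)

  match-pass : ∀ {p a} b σ → ¬ LoopLetter p a → b ≢ just a → match ((p , b) ∷ σ) a ≡ match σ a
  match-pass {p} {a} b σ ¬l ¬e with loopLetter? p a | exit? b a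
  ... | yes l | _     = ⊥-elim (¬l l)
  ... | no  _ | yes e = ⊥-elim (¬e e)
  ... | no  _ | no  _ = refl

  match-suffix : ∀ σ a τ → match σ a ≡ just τ → ∃ λ ρ → σ ≡ ρ ++ τ
  match-suffix ((p , b) ∷ σ) a τ eq with loopLetter? p a | exit? b a
  ... | yes _ | _     = [] , just-injective eq
  ... | no  _ | yes _ = (p , b) ∷ [] , cong ((p , b) ∷_) (just-injective eq)
  ... | no  _ | no  _ with match-suffix σ a τ eq
  ...   | ρ , e = (p , b) ∷ ρ , cong ((p , b) ∷_) e

  match-++ : ∀ σ τ a σ′ → match σ a ≡ just σ′ → match (σ ++ τ) a ≡ just (σ′ ++ τ)
  match-++ ((p , b) ∷ σ) τ a σ′ eq with loopLetter? p a | exit? b a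
  ... | yes _ | _     = cong (λ ρ → just (ρ ++ τ)) (just-injective eq)
  ... | no  _ | yes _ = cong (λ ρ → just (ρ ++ τ)) (just-injective eq)
  ... | no  _ | no  _ = match-++ σ τ a σ′ eq

  open PartialRun match public

  Matches : Skeleton → List Λ → Set
  Matches σ x = survives (just σ) x ≡ true

  mutual
    matches-∷ : ∀ e σ x → Matches σ x → Matches (e ∷ σ) x
    matches-∷ e       σ []      _ = refl
    matches-∷ (p , b) σ (a ∷ x) m with loopLetter? p a | exit? b a
    ... | yes _ | _      = matches-∷ (p , b) σ x (matches-tail σ a x m)
    ... | no  _ | yes _  = matches-tail σ a x m
    ... | no  _ | no  _  = m

    matches-tail : ∀ σ a x → Matches σ (a ∷ x) → Matches σ x
    matches-tail σ a x m with match σ a in eq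
    ... | nothing with () ← m
    ... | just τ with match-suffix σ a τ eq
    ...   | ρ , refl = matches-++ˡ ρ τ x m

    matches-++ˡ : ∀ ρ σ x → Matches σ x → Matches (ρ ++ σ) x
    matches-++ˡ []      σ x m = m
    matches-++ˡ (e ∷ ρ) σ x m = matches-∷ e (ρ ++ σ) x (matches-++ˡ ρ σ x m)

  matches-++ʳ : ∀ σ τ x → Matches σ x → Matches (σ ++ τ) x
  matches-++ʳ σ τ []      _ = refl
  matches-++ʳ σ τ (a ∷ x) m with match σ a in eq
  ... | nothing with () ← m
  ... | just σ′ rewrite match-++ σ τ a σ′ eq = matches-++ʳ σ′ τ x m

  -- σ can be followed by a run from s to f: reach each pivot p, wander to some r, and
  -- leave through the exit letter of the segment.
  Valid : Q → Skeleton → Q → Set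
  Valid s []            f = Reach s f
  Valid s ((p , b) ∷ σ) f = Reach s p × ∃ λ r → Reach p r × Valid (run r (fromMaybe b)) σ f

  valid? : ∀ s σ f → Dec (Valid s σ f)
  valid? s []            f = reach? s f
  valid? s ((p , b) ∷ σ) f = reach? s p ×-dec any? λ r → reach? p r ×-dec valid? (run r (fromMaybe b)) σ f

  valid-pad : ∀ {s σ f} → Valid s σ f → ∀ r → Valid s (σ ++ replicate r (f , nothing)) f
  valid-pad {σ = []}    sf ℕ.zero    = sf
  valid-pad {σ = []}    sf (ℕ.suc r) = sf , _ , reach-refl , valid-pad {σ = []} reach-refl r
  valid-pad {σ = _ ∷ _} (sp , q , pq , v) r = sp , q , pq , valid-pad v r

  CommonRun : Q → Q → List Λ → List Λ → Set
  CommonRun s f x y = ∃ λ u → run s u ≡ f × x ⪯ u × y ⪯ u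

  prepend : ∀ {s q f x y x′ y′} w → run s w ≡ q →
            (∀ {u} → x′ ⪯ u → x ⪯ (w ++ u)) → (∀ {u} → y′ ⪯ u → y ⪯ (w ++ u)) →
            CommonRun q f x′ y′ → CommonRun s f x y
  prepend {s} w refl kx ky (u , e , xu , yu) = w ++ u , trans (run-++ s w u) e , kx xu , ky yu

  NoLoopHead : Q → List Λ → Set
  NoLoopHead p []      = ⊤
  NoLoopHead p (a ∷ _) = ¬ LoopLetter p a

  data HeadView (p : Q) : List Λ → Set where
    loop-head    : ∀ {a x} → LoopLetter p a → HeadView p (a ∷ x)
    no-loop-head : ∀ {x} → NoLoopHead p x → HeadView p x

  headView : ∀ p x → HeadView p x
  headView p []      = no-loop-head tt
  headView p (a ∷ x) with loopLetter? p a
  ... | yes l = loop-head l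
  ... | no ¬l = no-loop-head ¬l

  leave-exit : ∀ {p c σ} a x → Dec (c ≡ a) → ¬ LoopLetter p a → Matches ((p , just c) ∷ σ) (a ∷ x) →
               ∃ λ x° → Matches σ x° × (∀ {u} → x° ⪯ u → (a ∷ x) ⪯ (c ∷ u))
  leave-exit {σ = σ} a x (yes refl) ¬l m =
    x , subst (λ t → survives t x ≡ true) (match-exit σ ¬l) m , refl ∷_
  leave-exit {c = c} {σ} a x (no c≢a) ¬l m =
    a ∷ x , subst (λ t → survives t x ≡ true) (match-pass (just c) σ ¬l (c≢a ∘ just-injective)) m , c ∷ʳ_

  leave : ∀ {p b σ} x → NoLoopHead p x → Matches ((p , b) ∷ σ) x →
          ∃ λ x° → Matches σ x° × (∀ {u} → x° ⪯ u → x ⪯ (fromMaybe b ++ u))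
  leave                     []      _  _ = [] , refl , λ _ → []⊆-universal _
  leave {b = nothing} {σ}   (a ∷ x) ¬l m =
    a ∷ x , subst (λ t → survives t x ≡ true) (match-pass nothing σ ¬l λ ()) m , id
  leave {b = just c}        (a ∷ x) ¬l m = leave-exit a x (c ≟ a) ¬l m

  -- Two words matched by a valid skeleton embed into one word along a run: loop letters
  -- at the current pivot are produced by going once around a loop through them.
  mutual
    sound : ∀ s σ f x y → Valid s σ f → Matches σ x → Matches σ y → CommonRun s f x y
    sound s []            f []      []      sf _ _ = proj₁ sf , proj₂ sf , []⊆-universal _ , []⊆-universal _
    sound s ((p , b) ∷ σ) f x       y       ((w , sp) , v) mx my =
      prepend w sp (++⁺ˡ w) (++⁺ˡ w) (soundAt p b σ f x y v mx my)

    soundAt : ∀ p b σ f x y → (∃ λ r → Reach p r × Valid (run r (fromMaybe b)) σ f) →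
              Matches ((p , b) ∷ σ) x → Matches ((p , b) ∷ σ) y → CommonRun p f x y
    soundAt p b σ f x y v mx my with headView p x | headView p y
    soundAt p b σ f (a ∷ x) y v mx my | loop-head l | _ with loopAround l
    ... | w , e , around = prepend w e around (++⁺ˡ w)
                             (soundAt p b σ f x y v (subst (λ t → survives t x ≡ true) (match-loop b σ l) mx) my)
    soundAt p b σ f x (a ∷ y) v mx my | no-loop-head _ | loop-head l with loopAround l
    ... | w , e , around = prepend w e (++⁺ˡ w) around
                             (soundAt p b σ f x y v mx (subst (λ t → survives t y ≡ true) (match-loop b σ l) my))
    soundAt p b σ f x y (r , (w , pr) , v) mx my | no-loop-head nx | no-loop-head ny
      with leave x nx mx | leave y ny my
    ... | x° , mx° , kx | y° , my° , ky =
      prepend (w ++ fromMaybe b) (trans (run-++ p w (fromMaybe b)) (cong (λ q → run q (fromMaybe b)) pr))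
              (λ {u} xu → subst (x ⪯_) (sym (++-assoc w (fromMaybe b) u)) (++⁺ˡ w (kx xu)))
              (λ {u} yu → subst (y ⪯_) (sym (++-assoc w (fromMaybe b) u)) (++⁺ˡ w (ky yu)))
              (sound (run r (fromMaybe b)) σ f x° y° v mx° my°)

  matches-loops : ∀ {p b σ v} u → All (LoopLetter p) u → (∀ {x} → x ⪯ v → Matches ((p , b) ∷ σ) x) →
                  ∀ {x} → x ⪯ (u ++ v) → Matches ((p , b) ∷ σ) x
  matches-loops []      _        base xv         = base xv
  matches-loops (a ∷ u) (_ ∷ ls) base (_ ∷ʳ xu) = matches-loops u ls base xu
  matches-loops {b = b} {σ} (a ∷ u) (l ∷ ls) base {a ∷ x} (refl ∷ xu) =
    subst (λ t → survives t x ≡ true) (sym (match-loop b σ l)) (matches-loops u ls base xu)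

  matches-exit : ∀ {p a σ v} → (∀ {x} → x ⪯ v → Matches σ x) → ∀ {x} → x ⪯ (a ∷ v) → Matches ((p , just a) ∷ σ) x
  matches-exit {p} {a} {σ} m {x} (_ ∷ʳ xv) = matches-∷ (p , just a) σ x (m xv)
  matches-exit {p} {a} {σ} m {a ∷ x} (refl ∷ xv) = viaLoop? (loopLetter? p a)
    where
      viaLoop? : Dec (LoopLetter p a) → Matches ((p , just a) ∷ σ) (a ∷ x)
      viaLoop? (yes l) = subst (λ t → survives t x ≡ true) (sym (match-loop (just a) σ l)) (matches-∷ (p , just a) σ x (m xv))
      viaLoop? (no ¬l) = subst (λ t → survives t x ≡ true) (sym (match-exit σ ¬l)) (m xv)

  complete : ∀ {s z} (d : Loops s z) →
             Σ Skeleton λ σ → length σ ≡ size d × Valid s σ (run s z) × (∀ {x} → x ⪯ z → Matches σ x)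
  complete {s} {z} (last r) =
    (s , nothing) ∷ [] , refl , (reach-refl , s , reach-refl , z , refl) ,
    λ xz → matches-loops {v = []} z (loopLetters z reach-refl r) (λ { [] → refl }) (subst (_ ⪯_) (sym (++-identityʳ z)) xz)
  complete {s} (step {u} {a} {v} r d) with complete d
  ... | σ , len , valid , matches =
    (s , just a) ∷ σ , cong ℕ.suc len ,
    (reach-refl , s , reach-refl , subst (Valid (δ s a) σ) (sym run-step) valid) ,
    matches-loops u (loopLetters u reach-refl r) (matches-exit matches)
    where
      run-step : run s (u ++ a ∷ v) ≡ run (δ s a) v
      run-step = trans (run-++ s u (a ∷ v)) (cong (λ q → run q (a ∷ v)) r)

  -- A skeleton padded to length n, paired with the state its run should end in.
  Candidate : Set
  Candidate = Q × Vec Segment n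

  Accepting : Candidate → Set
  Accepting (f , σ) = Valid start (toList σ) f × final f ≡ true

  accepting? : ∀ c → Dec (Accepting c)
  accepting? (f , σ) = valid? start (toList σ) f ×-dec (final f Bool.≟ true)

  Admits : Candidate → List Λ → List Λ → Set
  Admits c x y = Accepting c × Matches (toList (proj₂ c)) x × Matches (toList (proj₂ c)) y

  compatible⇔admits : ∀ x y → (∃ λ z → Accepts M z × x ⪯ z × y ⪯ z) ⇔ ∃ λ c → Admits c x y
  compatible⇔admits x y = mk⇔ to from
    where
      to : (∃ λ z → Accepts M z × x ⪯ z × y ⪯ z) → ∃ λ c → Admits c x y
      to (z , acc , xz , yz) with loops start z
      ... | d , d≤n with complete d
      ...   | σ , len , valid , matches with padTo n (run start z , nothing) σ (subst (_≤ n) (sym len) d≤n)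
      ...     | σ′ , r , eq =
        (run start z , σ′) ,
        (subst (λ τ → Valid start τ (run start z)) (sym eq) (valid-pad valid r) , acc) ,
        subst (λ τ → Matches τ x) (sym eq) (matches-++ʳ σ _ x (matches xz)) ,
        subst (λ τ → Matches τ y) (sym eq) (matches-++ʳ σ _ y (matches yz))
      from : (∃ λ c → Admits c x y) → ∃ λ z → Accepts M z × x ⪯ z × y ⪯ z
      from ((f , σ) , (valid , accepting) , mx , my) with sound start (toList σ) f x y valid mx my
      ... | z , e , xz , yz = z , subst (λ q → DFA.final M q ≡ true) (sym e) accepting , xz , yz

module SemiBadAutomaton {k : ℕ} (M : DFA (Fin k)) where
  open DFA M using () renaming (states to n)
  open Skeletons M

  K : ℕ
  K = n * (n * ℕ.suc k) ^ n

  candidates : Fin K ↔ Candidate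
  candidates = ↔-trans *↔× (↔-refl ×-↔ Vec-↔ n (↔-trans *↔× (↔-refl ×-↔ Maybe-↔ ↔-refl)))

  open Inverse candidates using () renaming (to to candidate; from to code; strictlyInverseˡ to candidate-code)

  skeleton : Fin K → Skeleton
  skeleton i = toList (proj₂ (candidate i))

  module Component (i : Fin K) =
    SuffixPositions match match-suffix n (skeleton i) (≤-reflexive (length-toList (proj₂ (candidate i))))

  Positions : Set
  Positions = Vec (Position n) K

  positions : Fin (ℕ.suc (ℕ.suc n) ^ K) ↔ Positions
  positions = Vec-↔ K (Maybe-↔ ↔-refl)

  Refutes : Positions → Fin K → Set
  Refutes v i = ¬ (Accepting (candidate i) × is-just (lookup v i) ≡ true)

  refutes? : ∀ v i → Dec (Refutes v i)
  refutes? v i = ¬? (accepting? (candidate i) ×-dec (is-just (lookup v i) Bool.≟ true))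

  machine : Machine Λ Positions
  machine = record
    { start  = Vec.replicate K (just zero)
    ; step   = stepAll Component.stepPosition
    ; accept = λ v → does (all? (refutes? v)) }

  private
    module N = Machine machine

  restartAll : Positions → Positions
  restartAll = Vec.map restart

  component-alive : ∀ x y i → is-just (lookup (N.run (restartAll (N.run N.start x)) y) i)
                     ≡ survives (just (skeleton i)) x ∧ survives (just (skeleton i)) y
  component-alive x y i = begin
    is-just (lookup (N.run (restartAll (N.run N.start x)) y) i)
      ≡⟨ cong is-just (lookup-runAll Component.stepPosition _ y i) ⟩
    is-just (foldl C.stepPosition (lookup (restartAll (N.run N.start x)) i) y)
      ≡⟨ cong (λ p → is-just (foldl C.stepPosition p y)) (lookup-map i restart (N.run N.start x)) ⟩
    is-just (foldl C.stepPosition (restart (lookup (N.run N.start x) i)) y)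
      ≡⟨ cong (λ p → is-just (foldl C.stepPosition (restart p) y)) (lookup-runAll Component.stepPosition _ x i) ⟩
    is-just (foldl C.stepPosition (restart (foldl C.stepPosition (lookup N.start i) x)) y)
      ≡⟨ cong (λ p → is-just (foldl C.stepPosition (restart (foldl C.stepPosition p x)) y)) (lookup-replicate i _) ⟩
    is-just (foldl C.stepPosition (restart (foldl C.stepPosition (just zero) x)) y)
      ≡⟨ C.is-just-restart x y ⟩
    survives (just (skeleton i)) x ∧ survives (just (skeleton i)) y ∎
    where
      open ≡-Reasoning
      module C = Component i

  machine-accepts : ∀ x y → N.accept (N.run (restartAll (N.run N.start x)) y) ≡ true ⇔ SemiBad (Accepts M) x y
  machine-accepts x y = ⇔.trans (does⇔ (all? (refutes? v))) (mk⇔ to from)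
    where
      v : Positions
      v = N.run (restartAll (N.run N.start x)) y
      alive⇔ : ∀ i → is-just (lookup v i) ≡ true ⇔ (Matches (skeleton i) x × Matches (skeleton i) y)
      alive⇔ i = ⇔.trans (mk⇔ (trans (sym (component-alive x y i))) (trans (component-alive x y i))) ∧≡true
      to : (∀ i → Refutes v i) → SemiBad (Accepts M) x y
      to refuted common with Equivalence.to (compatible⇔admits x y) common
      ... | c , admits with subst (λ c → Admits c x y) (sym (candidate-code c)) admits
      ...   | acc , mx , my = refuted (code c) (acc , Equivalence.from (alive⇔ (code c)) (mx , my))
      from : SemiBad (Accepts M) x y → ∀ i → Refutes v i
      from semibad i (acc , alive) =
        semibad (Equivalence.from (compatible⇔admits x y) (candidate i , acc , Equivalence.to (alive⇔ i) alive))

  dfa : DFA (Fin k ⊎ ⊤)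
  dfa = toDFA (Phase-↔ positions) (separated machine restartAll)

  dfa-accepts : ∀ w → Accepts dfa w ⇔ B′ (Accepts M) w
  dfa-accepts w = ⇔.trans (toDFA-accepts (Phase-↔ positions) (separated machine restartAll) w)
                          (separated-accepts machine restartAll machine-accepts w)

lemma3 : (k : ℕ) →
    Σ (DFA (Fin k) → DFA (Fin k ⊎ ⊤)) λ build →
    (M : DFA (Fin k)) (w : List (Fin k ⊎ ⊤)) →
    Accepts (build M) w ⇔ B′ (Accepts M) w
lemma3 k = SemiBadAutomaton.dfa , SemiBadAutomaton.dfa-accepts
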